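{- Let $k\ge 0$ be an integer and let $D$ be a $k$-regular digraph, i.e. every vertex $v$ satisfies $d^-(v)=d^+(v)=k$. Then $\vec{\Delta}(D)=\Delta_{\min}(D)=\Delta_{\max}(D)=k$.
   Context: Digraphs are finite (and nonempty here) with no loops and at most one arc from $u$ to $v$ for distinct $u,v$. For a total ordering $\prec$ of $V(D)$, the backedge graph $D^{\prec}$ is the undirected graph on $V(D)$ whose edges are the pairs $\{u,v\}$ with $(u,v)\in A(D)$ and $v\prec u$; the degreewidth is $\vec{\Delta}(D)=\min_{\prec}\Delta(D^{\prec})$ over all total orderings. With $d^+,d^-$ denoting out- and in-degree, $\Delta_{\max}(D)=\max_{v}\max\{d^+(v),d^-(v)\}$ and $\Delta_{\min}(D)=\max_{v}\min\{d^+(v),d^-(v)\}$. -}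

module Defs where

open import Data.Nat using (ℕ; zero; suc; _+_; _<_; _≤_; _⊔_; _⊓_)
open import Data.Nat.Properties using (_<?_)
open import Data.Fin using (Fin; toℕ)
open import Data.Bool using (Bool; true; false; _∧_; _∨_; T)
open import Data.List using (List; length; filter; foldr; map)
open import Data.List.Base using (allFin)
open import Data.Product using (Σ; ∃; _×_; _,_)
open import Function.Bundles using (_↔_; Inverse)
open import Relation.Nullary.Decidable using (does)
open import Relation.Binary.PropositionalEquality using (_≡_)

-- A digraph on vertex set Fin n: arc relation as a Boolean adjacency function.
-- "At most one arc from u to v" is automatic; loops are excluded by `loopless`.
record Digraph (n : ℕ) : Set where
  field
    arc     : Fin n → Fin n → Bool
    loopless : ∀ v → arc v v ≡ false
open Digraph public

count : ∀ {n} → (Fin n → Bool) → ℕ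
count {n} p = length (filter (λ x → T? (p x)) (allFin n))
  where
    open import Data.Bool using (T?)

outdeg : ∀ {n} → Digraph n → Fin n → ℕ
outdeg D v = count (λ w → arc D v w)

indeg : ∀ {n} → Digraph n → Fin n → ℕ
indeg D v = count (λ w → arc D w v)

-- maximum of f over all vertices (0 for the empty vertex set)
maxOver : ∀ {n} → (Fin n → ℕ) → ℕ
maxOver {n} f = foldr _⊔_ 0 (map f (allFin n))

Δmax : ∀ {n} → Digraph n → ℕ
Δmax D = maxOver (λ v → outdeg D v ⊔ indeg D v)

Δmin : ∀ {n} → Digraph n → ℕ
Δmin D = maxOver (λ v → outdeg D v ⊓ indeg D v)

-- A total ordering of Fin n, given by a bijective position map σ:
-- u ≺ v  iff  toℕ (σ u) < toℕ (σ v).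
Ordering : ℕ → Set
Ordering n = Fin n ↔ Fin n

_≺?_ : ∀ {n} → Ordering n → Fin n → Fin n → Bool
(σ ≺? u) v = does (toℕ (Inverse.to σ u) <? toℕ (Inverse.to σ v))

backedge : ∀ {n} → Digraph n → Ordering n → Fin n → Fin n → Bool
backedge D σ u v = (arc D u v ∧ (σ ≺? v) u) ∨ (arc D v u ∧ (σ ≺? u) v)

backdeg : ∀ {n} → Digraph n → Ordering n → Fin n → ℕ
backdeg D σ v = count (λ w → backedge D σ v w)

Δback : ∀ {n} → Digraph n → Ordering n → ℕ
Δback D σ = maxOver (backdeg D σ)

IsDegreewidth : ∀ {n} → Digraph n → ℕ → Set
IsDegreewidth {n} D d =
  (Σ (Ordering n) λ σ → Δback D σ ≡ d) × (∀ (σ : Ordering n) → d ≤ Δback D σ)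

Regular : ∀ {n} → ℕ → Digraph n → Set
Regular {n} k D = ∀ (v : Fin n) → indeg D v ≡ k × outdeg D v ≡ k

-- A digraph has a vertex v with d⁻(v) ≤ d⁺(v), because in- and out-degrees
-- have equal sums. Placing such a v first and ordering D − v recursively gives
-- an ordering in which every vertex w has at most d⁺(w) back-edges: those of v
-- are exactly its in-arcs, and any other w gains only the edge to v, present
-- when w → v, an out-arc of w that D − v does not count. Conversely, in any
-- ordering the first vertex sees all its in-arcs as back-edges. For a k-regular
-- digraph the two bounds meet at k.
module Submission where

open import Defs
open import Data.Bool using (Bool; true; false; T; T?)
open import Data.Bool.Properties using (T-∨; T-∧; ∧-identityʳ; ∧-zeroʳ; ∨-identityʳ)
open import Data.Empty using (⊥-elim)
open import Data.Fin using (Fin; zero; suc; punchIn)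
open import Data.Fin.Permutation as Perm using (insert; insert-punchIn; _⟨$⟩ʳ_; _⟨$⟩ˡ_)
open import Data.Fin.Properties using (_≟_; punchIn-punchOut; any?)
open import Data.List using (tabulate; filter; length)
open import Data.List.Relation.Unary.All.Properties as All using ()
open import Data.List.Relation.Unary.Any.Properties as Any using ()
open import Data.List.Properties using (foldr-preservesᵇ; foldr-preservesᵒ)
open import Data.Nat using (ℕ; zero; suc; _+_; _≤_; _<_; z≤n; _⊓_; _⊔_)
open import Data.Nat.Properties
  using (+-0-commutativeMonoid; +-mono-≤; +-monoʳ-≤; ≤-refl; ≤-trans; ≤-antisym; ≤-reflexive;
         ⊔-lub; m≤m⊔n; m≤n⊔m; ⊓-idem; ⊔-idem; _≤?_; ≰⇒>; <⇒≤; <⇒≱; +-mono-<-≤;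
         module ≤-Reasoning)
open import Data.Product using (Σ; ∃; _×_; _,_; proj₁; proj₂)
open import Data.Sum using (_⊎_; inj₂; [_,_])
open import Function using (_∘_; id; Equivalence)
open import Relation.Binary.PropositionalEquality
  using (_≡_; _≗_; refl; sym; trans; cong; cong₂; subst; module ≡-Reasoning)
open import Relation.Nullary using (Dec; yes; no)

open import Algebra.Properties.CommutativeMonoid.Sum +-0-commutativeMonoid
  using (sum; sum-remove; ∑-comm; sum-cong-≗)

⟦_⟧ : Bool → ℕ
⟦ true ⟧ = 1
⟦ false ⟧ = 0

⟦⟧-mono : ∀ {a b} → (T a → T b) → ⟦ a ⟧ ≤ ⟦ b ⟧
⟦⟧-mono {false} _ = z≤n
⟦⟧-mono {true} {true} _ = ≤-refl
⟦⟧-mono {true} {false} a⇒b = ⊥-elim (a⇒b _)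

sum-mono-≤ : ∀ {n} {f g : Fin n → ℕ} → (∀ i → f i ≤ g i) → sum f ≤ sum g
sum-mono-≤ {zero} _ = z≤n
sum-mono-≤ {suc n} f≤g = +-mono-≤ (f≤g zero) (sum-mono-≤ (f≤g ∘ suc))

sum-mono-< : ∀ {n} {f g : Fin (suc n) → ℕ} → (∀ i → f i < g i) → sum f < sum g
sum-mono-< f<g = +-mono-<-≤ (f<g zero) (sum-mono-≤ (<⇒≤ ∘ f<g ∘ suc))

sum-≤⇒∃-≤ : ∀ {n} (f g : Fin (suc n) → ℕ) → sum f ≤ sum g → ∃ λ i → f i ≤ g i
sum-≤⇒∃-≤ f g ∑f≤∑g with any? (λ i → f i ≤? g i)
... | yes fi≤gi = fi≤gi
... | no ∄fi≤gi = ⊥-elim (<⇒≱ (sum-mono-< (λ i → ≰⇒> (∄fi≤gi ∘ (i ,_)))) ∑f≤∑g)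

length-filter-tabulate : ∀ {A : Set} {n} (p : A → Bool) (f : Fin n → A) →
  length (filter (T? ∘ p) (tabulate f)) ≡ sum (λ i → ⟦ p (f i) ⟧)
length-filter-tabulate {n = zero} p f = refl
length-filter-tabulate {n = suc n} p f with p (f zero)
... | true = cong suc (length-filter-tabulate p (f ∘ suc))
... | false = length-filter-tabulate p (f ∘ suc)

count≡sum : ∀ {n} (p : Fin n → Bool) → count p ≡ sum (λ i → ⟦ p i ⟧)
count≡sum p = length-filter-tabulate p id

count-cong : ∀ {n} {p q : Fin n → Bool} → p ≗ q → count p ≡ count q
count-cong {p = p} {q} p≗q = begin
  count p               ≡⟨ count≡sum p ⟩
  sum (λ i → ⟦ p i ⟧)   ≡⟨ sum-cong-≗ (cong ⟦_⟧ ∘ p≗q) ⟩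
  sum (λ i → ⟦ q i ⟧)   ≡⟨ count≡sum q ⟨
  count q               ∎
  where open ≡-Reasoning

count-mono : ∀ {n} {p q : Fin n → Bool} → (∀ i → T (p i) → T (q i)) → count p ≤ count q
count-mono {p = p} {q} p⇒q = begin
  count p               ≡⟨ count≡sum p ⟩
  sum (λ i → ⟦ p i ⟧)   ≤⟨ sum-mono-≤ (⟦⟧-mono ∘ p⇒q) ⟩
  sum (λ i → ⟦ q i ⟧)   ≡⟨ count≡sum q ⟨
  count q               ∎
  where open ≤-Reasoning

count-remove : ∀ {n} (p : Fin (suc n) → Bool) v → count p ≡ ⟦ p v ⟧ + count (p ∘ punchIn v)
count-remove p v = begin
  count p                                          ≡⟨ count≡sum p ⟩
  sum (λ i → ⟦ p i ⟧)                              ≡⟨ sum-remove (λ i → ⟦ p i ⟧) ⟩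
  ⟦ p v ⟧ + sum (λ i → ⟦ p (punchIn v i) ⟧)        ≡⟨ cong (⟦ p v ⟧ +_) (count≡sum (p ∘ punchIn v)) ⟨
  ⟦ p v ⟧ + count (p ∘ punchIn v)                  ∎
  where open ≡-Reasoning

sum-indeg≡sum-outdeg : ∀ {n} (D : Digraph n) → sum (indeg D) ≡ sum (outdeg D)
sum-indeg≡sum-outdeg D = begin
  sum (indeg D)                                  ≡⟨ sum-cong-≗ (λ v → count≡sum (λ u → arc D u v)) ⟩
  sum (λ v → sum (λ u → ⟦ arc D u v ⟧))          ≡⟨ ∑-comm (λ v u → ⟦ arc D u v ⟧) ⟩
  sum (λ u → sum (λ v → ⟦ arc D u v ⟧))          ≡⟨ sum-cong-≗ (λ u → count≡sum (arc D u)) ⟨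
  sum (outdeg D)                                 ∎
  where open ≡-Reasoning

∃-indeg≤outdeg : ∀ {n} (D : Digraph (suc n)) → ∃ λ v → indeg D v ≤ outdeg D v
∃-indeg≤outdeg D = sum-≤⇒∃-≤ (indeg D) (outdeg D) (≤-reflexive (sum-indeg≡sum-outdeg D))

_─_ : ∀ {n} → Digraph (suc n) → Fin (suc n) → Digraph n
arc      (D ─ v) a b = arc D (punchIn v a) (punchIn v b)
loopless (D ─ v) a   = loopless D (punchIn v a)

outdeg-punchIn : ∀ {n} (D : Digraph (suc n)) v a →
  outdeg D (punchIn v a) ≡ ⟦ arc D (punchIn v a) v ⟧ + outdeg (D ─ v) a
outdeg-punchIn D v a = count-remove (arc D (punchIn v a)) v

indeg≡count-punchIn : ∀ {n} (D : Digraph (suc n)) v →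
  indeg D v ≡ count (λ a → arc D (punchIn v a) v)
indeg≡count-punchIn D v
  rewrite count-remove (λ u → arc D u v) v | loopless D v = refl

putFirst : ∀ {n} → Fin (suc n) → Ordering n → Ordering (suc n)
putFirst v σ = insert v zero σ

putFirst-self : ∀ {n} v (σ : Ordering n) → putFirst v σ ⟨$⟩ʳ v ≡ zero
putFirst-self v σ with v ≟ v
... | yes _ = refl
... | no v≢v = ⊥-elim (v≢v refl)

putFirst-≺?-punchIn : ∀ {n} v (σ : Ordering n) a b →
  (putFirst v σ ≺? punchIn v a) (punchIn v b) ≡ (σ ≺? a) b
putFirst-≺?-punchIn v σ a b
  rewrite insert-punchIn v zero σ a | insert-punchIn v zero σ b = refl

putFirst-self≺punchIn : ∀ {n} v (σ : Ordering n) a → (putFirst v σ ≺? v) (punchIn v a) ≡ true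
putFirst-self≺punchIn v σ a rewrite putFirst-self v σ | insert-punchIn v zero σ a = refl

putFirst-punchIn⊀self : ∀ {n} v (σ : Ordering n) a → (putFirst v σ ≺? punchIn v a) v ≡ false
putFirst-punchIn⊀self v σ a rewrite putFirst-self v σ = refl

backedge-irrefl : ∀ {n} (D : Digraph n) σ v → backedge D σ v v ≡ false
backedge-irrefl D σ v rewrite loopless D v = refl

module _ {n} (D : Digraph (suc n)) (v : Fin (suc n)) (σ : Ordering n) where

  private
    ρ : Ordering (suc n)
    ρ = putFirst v σ

  backedge-self-punchIn : ∀ a → backedge D ρ v (punchIn v a) ≡ arc D (punchIn v a) v
  backedge-self-punchIn a
    rewrite putFirst-punchIn⊀self v σ a | putFirst-self≺punchIn v σ a
          | ∧-zeroʳ (arc D v (punchIn v a)) | ∧-identityʳ (arc D (punchIn v a) v) = refl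

  backedge-punchIn-self : ∀ a → backedge D ρ (punchIn v a) v ≡ arc D (punchIn v a) v
  backedge-punchIn-self a
    rewrite putFirst-punchIn⊀self v σ a | putFirst-self≺punchIn v σ a
          | ∧-zeroʳ (arc D v (punchIn v a)) | ∧-identityʳ (arc D (punchIn v a) v) = ∨-identityʳ _

  backedge-punchIn-punchIn : ∀ a b →
    backedge D ρ (punchIn v a) (punchIn v b) ≡ backedge (D ─ v) σ a b
  backedge-punchIn-punchIn a b
    rewrite putFirst-≺?-punchIn v σ a b | putFirst-≺?-punchIn v σ b a = refl

  backdeg-putFirst-self : backdeg D ρ v ≡ indeg D v
  backdeg-putFirst-self = begin
    backdeg D ρ v                                ≡⟨ count-remove back v ⟩
    ⟦ back v ⟧ + count (back ∘ punchIn v)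
      ≡⟨ cong (λ b → ⟦ b ⟧ + count (back ∘ punchIn v)) (backedge-irrefl D ρ v) ⟩
    count (back ∘ punchIn v)                     ≡⟨ count-cong backedge-self-punchIn ⟩
    count (λ a → arc D (punchIn v a) v)          ≡⟨ indeg≡count-punchIn D v ⟨
    indeg D v                                    ∎
    where
    open ≡-Reasoning
    back : Fin (suc n) → Bool
    back = backedge D ρ v

  backdeg-putFirst-punchIn : ∀ a →
    backdeg D ρ (punchIn v a) ≡ ⟦ arc D (punchIn v a) v ⟧ + backdeg (D ─ v) σ a
  backdeg-putFirst-punchIn a = begin
    backdeg D ρ w                                ≡⟨ count-remove (backedge D ρ w) v ⟩
    ⟦ backedge D ρ w v ⟧ + count (backedge D ρ w ∘ punchIn v)
      ≡⟨ cong₂ _+_ (cong ⟦_⟧ (backedge-punchIn-self a)) (count-cong (backedge-punchIn-punchIn a)) ⟩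
    ⟦ arc D w v ⟧ + backdeg (D ─ v) σ a          ∎
    where
    open ≡-Reasoning
    w : Fin (suc n)
    w = punchIn v a

  putFirst-backdeg≤outdeg : indeg D v ≤ outdeg D v →
    (∀ a → backdeg (D ─ v) σ a ≤ outdeg (D ─ v) a) → ∀ w → backdeg D ρ w ≤ outdeg D w
  putFirst-backdeg≤outdeg in≤out bound w = by-cases (v ≟ w)
    where
    open ≤-Reasoning
    P : Fin (suc n) → Set
    P u = backdeg D ρ u ≤ outdeg D u

    bound-self : P v
    bound-self = begin
      backdeg D ρ v   ≡⟨ backdeg-putFirst-self ⟩
      indeg D v       ≤⟨ in≤out ⟩
      outdeg D v      ∎

    bound-punchIn : ∀ a → P (punchIn v a)
    bound-punchIn a = begin
      backdeg D ρ (punchIn v a)                           ≡⟨ backdeg-putFirst-punchIn a ⟩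
      ⟦ arc D (punchIn v a) v ⟧ + backdeg (D ─ v) σ a     ≤⟨ +-monoʳ-≤ _ (bound a) ⟩
      ⟦ arc D (punchIn v a) v ⟧ + outdeg (D ─ v) a        ≡⟨ outdeg-punchIn D v a ⟨
      outdeg D (punchIn v a)                              ∎

    by-cases : Dec (v ≡ w) → P w
    by-cases (yes v≡w) = subst P v≡w bound-self
    by-cases (no v≢w) = subst P (punchIn-punchOut v≢w) (bound-punchIn _)

ordering-backdeg≤outdeg : ∀ {n} (D : Digraph n) →
  Σ (Ordering n) λ σ → ∀ v → backdeg D σ v ≤ outdeg D v
ordering-backdeg≤outdeg {zero} D = Perm.id , λ ()
ordering-backdeg≤outdeg {suc n} D =
  let v , in≤out = ∃-indeg≤outdeg D
      σ , bound = ordering-backdeg≤outdeg (D ─ v)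
  in putFirst v σ , putFirst-backdeg≤outdeg D v σ in≤out bound

indeg≤backdeg-first : ∀ {n} (D : Digraph (suc n)) (τ : Ordering (suc n)) v →
  τ ⟨$⟩ʳ v ≡ zero → indeg D v ≤ backdeg D τ v
indeg≤backdeg-first D τ v τv≡0 = count-mono in-arc⇒backedge
  where
  in-arc⇒backedge : ∀ w → T (arc D w v) → T (backedge D τ v w)
  in-arc⇒backedge w wv rewrite τv≡0 with τ ⟨$⟩ʳ w in τw≡
  ... | suc _ = Equivalence.from T-∨ (inj₂ (Equivalence.from T-∧ (wv , _)))
  ... | zero = ⊥-elim (subst T (loopless D v) (subst (λ u → T (arc D u v)) w≡v wv))
    where
    open ≡-Reasoning
    w≡v : w ≡ v
    w≡v = begin
      w                      ≡⟨ Perm.inverseˡ τ ⟨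
      τ ⟨$⟩ˡ (τ ⟨$⟩ʳ w)      ≡⟨ cong (τ ⟨$⟩ˡ_) (trans τw≡ (sym τv≡0)) ⟩
      τ ⟨$⟩ˡ (τ ⟨$⟩ʳ v)      ≡⟨ Perm.inverseˡ τ ⟩
      v                      ∎

maxOver-lub : ∀ {n} {f : Fin n → ℕ} {k} → (∀ i → f i ≤ k) → maxOver f ≤ k
maxOver-lub {k = k} f≤k = foldr-preservesᵇ {P = _≤ k} ⊔-lub z≤n (All.map⁺ (All.tabulate⁺ f≤k))

≤-maxOver : ∀ {n} (f : Fin n → ℕ) i → f i ≤ maxOver f
≤-maxOver f i = foldr-preservesᵒ {P = f i ≤_} ≤-⊔ 0 _ (inj₂ (Any.map⁺ (Any.tabulate⁺ i ≤-refl)))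
  where
  ≤-⊔ : ∀ x y → f i ≤ x ⊎ f i ≤ y → f i ≤ x ⊔ y
  ≤-⊔ x y = [ (λ fi≤x → ≤-trans fi≤x (m≤m⊔n x y))
            , (λ fi≤y → ≤-trans fi≤y (m≤n⊔m x y)) ]

maxOver-const : ∀ {n} {f : Fin (suc n) → ℕ} {k} → (∀ i → f i ≡ k) → maxOver f ≡ k
maxOver-const {f = f} f≡k =
  ≤-antisym (maxOver-lub (≤-reflexive ∘ f≡k))
            (subst (_≤ maxOver f) (f≡k zero) (≤-maxOver f zero))

corollary3p4 : (k n : ℕ) (D : Digraph (suc n)) → Regular k D →
    IsDegreewidth D k × Δmin D ≡ k × Δmax D ≡ k
corollary3p4 k n D regular with σ , backdeg≤outdeg ← ordering-backdeg≤outdeg D =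
  ((σ , Δback-σ≡k) , k≤Δback) , Δmin≡k , Δmax≡k
  where
  open ≤-Reasoning

  k≤Δback : ∀ τ → k ≤ Δback D τ
  k≤Δback τ = begin
    k                 ≡⟨ proj₁ (regular v) ⟨
    indeg D v         ≤⟨ indeg≤backdeg-first D τ v (Perm.inverseʳ τ) ⟩
    backdeg D τ v     ≤⟨ ≤-maxOver (backdeg D τ) v ⟩
    Δback D τ         ∎
    where
    v : Fin (suc n)
    v = τ ⟨$⟩ˡ zero

  Δback-σ≡k : Δback D σ ≡ k
  Δback-σ≡k = ≤-antisym
    (maxOver-lub (λ v → subst (backdeg D σ v ≤_) (proj₂ (regular v)) (backdeg≤outdeg v)))
    (k≤Δback σ)

  Δmin≡k : Δmin D ≡ k
  Δmin≡k = maxOver-const λ v →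
    trans (cong₂ _⊓_ (proj₂ (regular v)) (proj₁ (regular v))) (⊓-idem k)

  Δmax≡k : Δmax D ≡ k
  Δmax≡k = maxOver-const λ v →
    trans (cong₂ _⊔_ (proj₂ (regular v)) (proj₁ (regular v))) (⊔-idem k)
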